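{- Let $G$ be a graph on $n$ vertices with $m$ edges, let $F_1,F_2$ be arbitrary graphs, let $r=|V(F_1)|\leq n$, and let $t$ be an integer with $1\leq t\leq r$. Put $m'=m-\mathrm{ex}(n-r,F_2)-\binom{r}{2}$. If the disjoint union $F_1\cup F_2$ is not a subgraph of $G$, then every copy of $F_1$ in $G$ contains a set of $t$ vertices whose common neighbourhood in $G$ has size at least \[\frac{m'-(n-r)(t-1)}{r-t+1}\Big/\binom{r}{t}.\]
   Context: For a graph $H$, $\mathrm{ex}(N,H)$ is the maximum number of edges in a graph on $N$ vertices not containing $H$ as a (not necessarily induced) subgraph. $F_1\cup F_2$ denotes the vertex-disjoint union of $F_1$ and $F_2$. The common neighbourhood of a vertex set $S$ is the set of vertices adjacent to every vertex of $S$. -}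

module Defs where

open import Data.Bool using (Bool; true; false; _∧_; if_then_else_)
open import Data.Nat using (ℕ; zero; suc; _+_; _≤_; _<ᵇ_)
open import Data.Fin using (Fin; zero; suc; toℕ; splitAt)
open import Data.Sum using (_⊎_; inj₁; inj₂)
open import Data.Product using (Σ; _×_; _,_; ∃)
open import Function.Definitions using (Injective)
open import Relation.Binary.PropositionalEquality using (_≡_; refl; sym)
open import Relation.Nullary using (¬_)

record Graph (n : ℕ) : Set where
  field
    adj    : Fin n → Fin n → Bool
    adj-sym    : ∀ i j → adj i j ≡ adj j i
    adj-irrefl : ∀ i → adj i i ≡ false
open Graph public

count : ∀ {n} → (Fin n → Bool) → ℕ
count {zero}  p = 0
count {suc n} p = (if p zero then 1 else 0) + count (λ i → p (suc i))

sumFin : ∀ {n} → (Fin n → ℕ) → ℕ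
sumFin {zero}  f = 0
sumFin {suc n} f = f zero + sumFin (λ i → f (suc i))

edgeCount : ∀ {n} → Graph n → ℕ
edgeCount G = sumFin (λ i → count (λ j → (toℕ i <ᵇ toℕ j) ∧ adj G i j))

-- An embedding of H into G (a copy of H in G, not necessarily induced):
-- an injective map on vertices sending edges to edges.
Embedding : ∀ {k n} → Graph k → Graph n → Set
Embedding {k} {n} H G =
  Σ (Fin k → Fin n) λ f →
    Injective _≡_ _≡_ f × (∀ i j → adj H i j ≡ true → adj G (f i) (f j) ≡ true)

_⊆G_ : ∀ {k n} → Graph k → Graph n → Set
H ⊆G G = Embedding H G

private
  uadj : ∀ {a b} → Graph a → Graph b → Fin a ⊎ Fin b → Fin a ⊎ Fin b → Bool
  uadj F₁ F₂ (inj₁ i) (inj₁ j) = adj F₁ i j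
  uadj F₁ F₂ (inj₂ i) (inj₂ j) = adj F₂ i j
  uadj F₁ F₂ (inj₁ i) (inj₂ j) = false
  uadj F₁ F₂ (inj₂ i) (inj₁ j) = false

  uadj-sym : ∀ {a b} (F₁ : Graph a) (F₂ : Graph b) x y → uadj F₁ F₂ x y ≡ uadj F₁ F₂ y x
  uadj-sym F₁ F₂ (inj₁ i) (inj₁ j) = adj-sym F₁ i j
  uadj-sym F₁ F₂ (inj₂ i) (inj₂ j) = adj-sym F₂ i j
  uadj-sym F₁ F₂ (inj₁ i) (inj₂ j) = refl
  uadj-sym F₁ F₂ (inj₂ i) (inj₁ j) = refl

  uadj-irr : ∀ {a b} (F₁ : Graph a) (F₂ : Graph b) x → uadj F₁ F₂ x x ≡ false
  uadj-irr F₁ F₂ (inj₁ i) = adj-irrefl F₁ i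
  uadj-irr F₁ F₂ (inj₂ i) = adj-irrefl F₂ i

_∪G_ : ∀ {a b} → Graph a → Graph b → Graph (a + b)
_∪G_ {a} F₁ F₂ = record
  { adj        = λ x y → uadj F₁ F₂ (splitAt a x) (splitAt a y)
  ; adj-sym    = λ x y → uadj-sym F₁ F₂ (splitAt a x) (splitAt a y)
  ; adj-irrefl = λ x → uadj-irr F₁ F₂ (splitAt a x)
  }

IsEx : ∀ {k} → ℕ → Graph k → ℕ → Set
IsEx N H e =
  (Σ (Graph N) λ G → ¬ (H ⊆G G) × edgeCount G ≡ e)
  × (∀ (G : Graph N) → ¬ (H ⊆G G) → edgeCount G ≤ e)

VSet : ℕ → Set
VSet n = Fin n → Bool

size : ∀ {n} → VSet n → ℕ
size = count

allFin : ∀ {n} → (Fin n → Bool) → Bool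
allFin {zero}  p = true
allFin {suc n} p = p zero ∧ allFin (λ i → p (suc i))

commonNbhd : ∀ {n} → Graph n → VSet n → VSet n
commonNbhd G S v = allFin (λ u → if S u then adj G u v else true)

InCopy : ∀ {r n} {F : Graph r} {G : Graph n} → Embedding F G → VSet n → Set
InCopy {r} (f , _) S = ∀ v → S v ≡ true → ∃ λ (i : Fin r) → f i ≡ v

-- Let X be the vertex set of the copy of F₁ and Y = V(G) ∖ X, so |X| = r and |Y| = n − r.
-- The graph G[Y] is F₂-free, since a copy of F₂ inside it would complete F₁ ∪ F₂;
-- hence e(Y) ≤ ex(n − r, F₂), and with e(X) ≤ C(r, 2) the number of X–Y edges is at least m'.
-- A vertex y ∈ Y with d_y neighbours in X satisfies d_y ≤ (t − 1) + (r − t + 1) C(d_y, t),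
-- so m' ≤ (n − r)(t − 1) + (r − t + 1) ∑_y C(d_y, t).  Counting the pairs (y, T) with T a
-- t-subset of X inside N(y), ∑_y C(d_y, t) = ∑_T |N(T) ∩ Y|, and some T is at least average:
-- |N(T)| ≥ ∑_y C(d_y, t) / C(r, t).
module Submission where

open import Defs
open import Data.Bool using (Bool; true; false; _∧_; not; if_then_else_)
open import Data.Bool.Properties using (not-injective) renaming (_≟_ to _≟ᵇ_)
open import Data.Empty using (⊥-elim)
open import Data.Fin using (Fin; zero; suc; toℕ; splitAt; join)
open import Data.Fin.Properties
  using (_≟_; any?; suc-injective; toℕ-injective; join-splitAt; injective⇒≤)
open import Data.Nat
  using (ℕ; zero; suc; _+_; _*_; _∸_; _≤_; _<_; _⊔_; z≤n; s≤s; _<ᵇ_; _<?_; _≤?_)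
open import Data.Nat.Properties hiding (_≟_; suc-injective)
open import Data.Nat.Combinatorics using (_C_; nC1≡n; nCk+nC[k+1]≡[n+1]C[k+1])
open import Data.Nat.Tactic.RingSolver using (solve-∀)
open import Algebra.Properties.Semiring.Sum +-*-semiring
  using (sum; sum-cong-≗; sum-replicate-zero; ∑-distrib-+; ∑-comm; *-distribˡ-sum)
open import Algebra.Properties.CommutativeSemigroup *-commutativeSemigroup using (x∙yz≈y∙xz)
open import Data.Product using (Σ; ∃; _×_; _,_; proj₁; proj₂)
open import Data.Sum using (_⊎_; inj₁; inj₂; [_,_]′)
import Data.Vec.Functional as Vector
open import Function using (_∘_)
open import Function.Definitions using (Injective)
open import Relation.Binary.Definitions using (tri<; tri≈; tri>)
open import Relation.Binary.PropositionalEquality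
open import Relation.Nullary using (¬_; Dec; yes; no; does)
open import Relation.Nullary.Decidable using (dec-true; dec-false; _×-dec_)

-- Counting and summing over Fin n

true≢false : true ≢ false
true≢false ()

does-true : ∀ {A : Set} (a? : Dec A) → does a? ≡ true → A
does-true (yes a) _ = a

indicator : Bool → ℕ
indicator b = if b then 1 else 0

indicator≤1 : ∀ b → indicator b ≤ 1
indicator≤1 true  = s≤s z≤n
indicator≤1 false = z≤n

sumFin≡sum : ∀ {n} (f : Fin n → ℕ) → sumFin f ≡ sum f
sumFin≡sum {zero}  f = refl
sumFin≡sum {suc n} f = cong (f zero +_) (sumFin≡sum (f ∘ suc))

count≡sum : ∀ {n} (p : Fin n → Bool) → count p ≡ sum (indicator ∘ p)
count≡sum {zero}  p = refl
count≡sum {suc n} p = cong (indicator (p zero) +_) (count≡sum (p ∘ suc))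

sum-mono-≤ : ∀ {n} {f g : Fin n → ℕ} → (∀ i → f i ≤ g i) → sum f ≤ sum g
sum-mono-≤ {zero}  f≤g = z≤n
sum-mono-≤ {suc n} f≤g = +-mono-≤ (f≤g zero) (sum-mono-≤ (f≤g ∘ suc))

sum-const : ∀ {n} a → sum {n} (λ _ → a) ≡ n * a
sum-const {zero}  a = refl
sum-const {suc n} a = cong (a +_) (sum-const {n} a)

count-cong : ∀ {n} {p q : Fin n → Bool} → (∀ i → p i ≡ q i) → count p ≡ count q
count-cong {zero}  p≗q = refl
count-cong {suc n} p≗q = cong₂ _+_ (cong indicator (p≗q zero)) (count-cong (p≗q ∘ suc))

count-mono : ∀ {n} {p q : Fin n → Bool} → (∀ i → p i ≡ true → q i ≡ true) → count p ≤ count q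
count-mono {zero}          p⇒q = z≤n
count-mono {suc n} {p} {q} p⇒q =
  +-mono-≤ (indicator-mono (p zero) (q zero) (p⇒q zero)) (count-mono (p⇒q ∘ suc))
  where
  indicator-mono : ∀ x y → (x ≡ true → y ≡ true) → indicator x ≤ indicator y
  indicator-mono false y _   = z≤n
  indicator-mono true  y x⇒y rewrite x⇒y refl = s≤s z≤n

count-const-false : ∀ n → count {n} (λ _ → false) ≡ 0
count-const-false zero    = refl
count-const-false (suc n) = count-const-false n

count≤n : ∀ {n} (p : Fin n → Bool) → count p ≤ n
count≤n {zero}  p = z≤n
count≤n {suc n} p = +-mono-≤ (indicator≤1 (p zero)) (count≤n (p ∘ suc))

count≤n∸1 : ∀ {n} (p : Fin n → Bool) k → p k ≡ false → count p ≤ n ∸ 1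
count≤n∸1 {suc n}       p zero    pk rewrite pk = count≤n (p ∘ suc)
count≤n∸1 {suc (suc n)} p (suc k) pk = +-mono-≤ (indicator≤1 (p zero)) (count≤n∸1 (p ∘ suc) k pk)

sum-count-comm : ∀ {m n} (p : Fin m → Fin n → Bool) →
  sum (λ i → count (p i)) ≡ sum (λ j → count (λ i → p i j))
sum-count-comm p = begin
  sum (λ i → count (p i))                        ≡⟨ sum-cong-≗ (λ i → count≡sum (p i)) ⟩
  sum (λ i → sum (λ j → indicator (p i j)))      ≡⟨ ∑-comm (λ i j → indicator (p i j)) ⟩
  sum (λ j → sum (λ i → indicator (p i j)))      ≡⟨ sum-cong-≗ (λ j → count≡sum (λ i → p i j)) ⟨
  sum (λ j → count (λ i → p i j))                ∎
  where open ≡-Reasoning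

allFin-intro : ∀ {n} (p : Fin n → Bool) → (∀ i → p i ≡ true) → allFin p ≡ true
allFin-intro {zero}  p all = refl
allFin-intro {suc n} p all rewrite all zero = allFin-intro (p ∘ suc) (all ∘ suc)

allFin-elim : ∀ {n} (p : Fin n → Bool) → allFin p ≡ true → ∀ i → p i ≡ true
allFin-elim {suc n} p all i with p zero in eq
allFin-elim {suc n} p all zero    | true = eq
allFin-elim {suc n} p all (suc i) | true = allFin-elim (p ∘ suc) all i

image? : ∀ {c n} (φ : Fin c → Fin n) (T : Fin c → Bool) v → Dec (∃ λ k → T k ≡ true × φ k ≡ v)
image? φ T v = any? λ k → (T k ≟ᵇ true) ×-dec (φ k ≟ v)

image : ∀ {c n} → (Fin c → Fin n) → (Fin c → Bool) → VSet n
image φ T v = does (image? φ T v)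

image-holds : ∀ {c n} (φ : Fin c → Fin n) T v → image φ T v ≡ true → ∃ λ k → T k ≡ true × φ k ≡ v
image-holds φ T v = does-true (image? φ T v)

image-at : ∀ {c n} {φ : Fin c → Fin n} → Injective _≡_ _≡_ φ → ∀ T k → image φ T (φ k) ≡ T k
image-at {φ = φ} φ-injective T k with T k in Tk
... | true  = dec-true (image? φ T (φ k)) (k , Tk , refl)
... | false = dec-false (image? φ T (φ k)) λ { (k′ , Tk′ , eq) →
  true≢false (trans (sym Tk′) (trans (cong T (φ-injective eq)) Tk)) }

range : ∀ {c n} → (Fin c → Fin n) → VSet n
range φ = image φ (λ _ → true)

range-contains : ∀ {c n} (φ : Fin c → Fin n) i → range φ (φ i) ≡ true
range-contains φ i = dec-true (image? φ (λ _ → true) (φ i)) (i , refl , refl)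

-- Enumerating a subset of Fin n

enumStep : ∀ {m n} (b : Bool) → (Fin m → Fin n) → Fin (indicator b + m) → Fin (suc n)
enumStep true  e zero    = zero
enumStep true  e (suc k) = suc (e k)
enumStep false e k       = suc (e k)

enum : ∀ {n} (P : Fin n → Bool) → Fin (count P) → Fin n
enum {zero}  P ()
enum {suc n} P = enumStep (P zero) (enum (P ∘ suc))

enum-holds : ∀ {n} (P : Fin n → Bool) k → P (enum P k) ≡ true
enum-holds {suc n} P k with P zero in eq
enum-holds {suc n} P zero    | true  = eq
enum-holds {suc n} P (suc k) | true  = enum-holds (P ∘ suc) k
enum-holds {suc n} P k       | false = enum-holds (P ∘ suc) k

enum-injective : ∀ {n} (P : Fin n → Bool) → Injective _≡_ _≡_ (enum P)
enum-injective {suc n} P {k} {k′} with P zero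
enum-injective {suc n} P {zero}  {zero}   | true  = λ _ → refl
enum-injective {suc n} P {suc k} {suc k′} | true  = cong suc ∘ enum-injective (P ∘ suc) ∘ suc-injective
enum-injective {suc n} P {k}     {k′}     | false = enum-injective (P ∘ suc) ∘ suc-injective

enum-surjective : ∀ {n} (P : Fin n → Bool) v → P v ≡ true → ∃ λ k → enum P k ≡ v
enum-surjective {suc n} P zero Pv with P zero
... | true = zero , refl
enum-surjective {suc n} P (suc v) Pv with P zero | enum-surjective (P ∘ suc) v Pv
... | true  | k , ek = suc k , cong suc ek
... | false | k , ek = k , cong suc ek

private
  sum-enumStep : ∀ {m n} (g : Fin (suc n) → ℕ) b (e : Fin m → Fin n) →
    sum (g ∘ enumStep b e) ≡ (if b then g zero else 0) + sum (g ∘ suc ∘ e)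
  sum-enumStep g true  e = refl
  sum-enumStep g false e = refl

  +-distribute-if : ∀ b x y z → x + (y + z) ≡ ((if b then x else 0) + y) + ((if not b then x else 0) + z)
  +-distribute-if true  x y z = sym (+-assoc x y z)
  +-distribute-if false x y z = trans (sym (+-assoc x y z)) (trans (cong (_+ z) (+-comm x y)) (+-assoc y x z))

sum-enum-split : ∀ {n} (P : Fin n → Bool) (g : Fin n → ℕ) →
  sum g ≡ sum (g ∘ enum P) + sum (g ∘ enum (not ∘ P))
sum-enum-split {zero}  P g = refl
sum-enum-split {suc n} P g = begin
  g zero + sum (g ∘ suc)
    ≡⟨ cong (g zero +_) (sum-enum-split (P ∘ suc) (g ∘ suc)) ⟩
  g zero + (sum (g ∘ suc ∘ eᵀ) + sum (g ∘ suc ∘ eᶠ))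
    ≡⟨ +-distribute-if (P zero) (g zero) _ _ ⟩
  ((if P zero then g zero else 0) + sum (g ∘ suc ∘ eᵀ))
    + ((if not (P zero) then g zero else 0) + sum (g ∘ suc ∘ eᶠ))
    ≡⟨ cong₂ _+_ (sum-enumStep g (P zero) eᵀ) (sum-enumStep g (not (P zero)) eᶠ) ⟨
  sum (g ∘ enum P) + sum (g ∘ enum (not ∘ P)) ∎
  where
  open ≡-Reasoning
  eᵀ : Fin (count (P ∘ suc)) → Fin n
  eᵀ = enum (P ∘ suc)
  eᶠ : Fin (count (not ∘ P ∘ suc)) → Fin n
  eᶠ = enum (not ∘ P ∘ suc)

record Split {n} (P : Fin n → Bool) (c s : ℕ) : Set where
  field
    inl           : Fin c → Fin n
    inr           : Fin s → Fin n
    inl-injective : Injective _≡_ _≡_ inl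
    inr-injective : Injective _≡_ _≡_ inr
    inl-holds     : ∀ k → P (inl k) ≡ true
    inr-fails     : ∀ b → P (inr b) ≡ false
    sum-split     : ∀ g → sum g ≡ sum (g ∘ inl) + sum (g ∘ inr)

  count-split : ∀ p → count p ≡ count (p ∘ inl) + count (p ∘ inr)
  count-split p = begin
    count p                                                ≡⟨ count≡sum p ⟩
    sum (indicator ∘ p)                                    ≡⟨ sum-split (indicator ∘ p) ⟩
    sum (indicator ∘ p ∘ inl) + sum (indicator ∘ p ∘ inr)
      ≡⟨ cong₂ _+_ (count≡sum (p ∘ inl)) (count≡sum (p ∘ inr)) ⟨
    count (p ∘ inl) + count (p ∘ inr)                      ∎
    where open ≡-Reasoning

  n≡c+s : n ≡ c + s
  n≡c+s = begin
    n                                      ≡⟨ *-identityʳ n ⟨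
    n * 1                                  ≡⟨ sum-const {n} 1 ⟨
    sum {n} (λ _ → 1)                      ≡⟨ sum-split (λ _ → 1) ⟩
    sum {c} (λ _ → 1) + sum {s} (λ _ → 1)  ≡⟨ cong₂ _+_ (sum-const {c} 1) (sum-const {s} 1) ⟩
    c * 1 + s * 1                          ≡⟨ cong₂ _+_ (*-identityʳ c) (*-identityʳ s) ⟩
    c + s                                  ∎
    where open ≡-Reasoning

  inr-avoids : ∀ {v} b → P v ≡ true → v ≢ inr b
  inr-avoids b Pv eq = true≢false (trans (sym Pv) (trans (cong P eq) (inr-fails b)))

  image-inr : ∀ T b → image inl T (inr b) ≡ false
  image-inr T b = dec-false (image? inl T (inr b)) λ { (k , _ , eq) → inr-avoids b (inl-holds k) eq }

  size-image : ∀ T → size (image inl T) ≡ count T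
  size-image T = begin
    count (image inl T)                                   ≡⟨ count-split (image inl T) ⟩
    count (image inl T ∘ inl) + count (image inl T ∘ inr)
      ≡⟨ cong₂ _+_ (count-cong (image-at inl-injective T)) (count-cong (image-inr T)) ⟩
    count T + count {s} (λ _ → false)                     ≡⟨ cong (count T +_) (count-const-false s) ⟩
    count T + 0                                           ≡⟨ +-identityʳ (count T) ⟩
    count T                                               ∎
    where open ≡-Reasoning

splitBy : ∀ {n} (P : Fin n → Bool) → Split P (count P) (count (not ∘ P))
splitBy P = record
  { inl           = enum P
  ; inr           = enum (not ∘ P)
  ; inl-injective = enum-injective P
  ; inr-injective = enum-injective (not ∘ P)
  ; inl-holds     = enum-holds P
  ; inr-fails     = λ b → not-injective {y = false} (enum-holds (not ∘ P) b)
  ; sum-split     = sum-enum-split P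
  }

module _ {r n} {φ : Fin r → Fin n} (φ-injective : Injective _≡_ _≡_ φ) where

  count-range : count (range φ) ≡ r
  count-range = ≤-antisym (injective⇒≤ preimage-injective) (injective⇒≤ index-injective)
    where
    P : VSet n
    P = range φ
    preimage : Fin (count P) → Fin r
    preimage k = proj₁ (image-holds φ _ (enum P k) (enum-holds P k))
    φ∘preimage : ∀ k → φ (preimage k) ≡ enum P k
    φ∘preimage k = proj₂ (proj₂ (image-holds φ _ (enum P k) (enum-holds P k)))
    preimage-injective : Injective _≡_ _≡_ preimage
    preimage-injective {k} {k′} eq =
      enum-injective P (trans (sym (φ∘preimage k)) (trans (cong φ eq) (φ∘preimage k′)))
    index : Fin r → Fin (count P)
    index i = proj₁ (enum-surjective P (φ i) (range-contains φ i))
    enum∘index : ∀ i → enum P (index i) ≡ φ i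
    enum∘index i = proj₂ (enum-surjective P (φ i) (range-contains φ i))
    index-injective : Injective _≡_ _≡_ index
    index-injective {i} {j} eq =
      φ-injective (trans (sym (enum∘index i)) (trans (cong (enum P) eq) (enum∘index j)))

  rangeSplit : Split (range φ) r (n ∸ r)
  rangeSplit = subst₂ (Split P) count-range |¬P|≡n∸r (splitBy P)
    where
    P : VSet n
    P = range φ
    |¬P|≡n∸r : count (not ∘ P) ≡ n ∸ r
    |¬P|≡n∸r = begin
      count (not ∘ P)                       ≡⟨ m+n∸m≡n (count P) _ ⟨
      count P + count (not ∘ P) ∸ count P   ≡⟨ cong₂ _∸_ (Split.n≡c+s (splitBy P)) (sym count-range) ⟨
      n ∸ r                                 ∎
      where open ≡-Reasoning

-- Binomial coefficients and sums over t-subsets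

nCk>0 : ∀ {n k} → k ≤ n → 0 < n C k
nCk>0 {n}     {zero}  _         = s≤s z≤n
nCk>0 {suc n} {suc k} (s≤s k≤n) =
  subst (0 <_) (nCk+nC[k+1]≡[n+1]C[k+1] n k) (≤-trans (nCk>0 k≤n) (m≤m+n _ _))

2*nC2≡n*[n∸1] : ∀ n → 2 * (n C 2) ≡ n * (n ∸ 1)
2*nC2≡n*[n∸1] zero          = refl
2*nC2≡n*[n∸1] (suc zero)    = refl
2*nC2≡n*[n∸1] (suc (suc n)) = begin
  2 * (suc (suc n) C 2)            ≡⟨ cong (2 *_) (nCk+nC[k+1]≡[n+1]C[k+1] (suc n) 1) ⟨
  2 * (suc n C 1 + suc n C 2)      ≡⟨ cong (λ x → 2 * (x + suc n C 2)) (nC1≡n (suc n)) ⟩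
  2 * (suc n + suc n C 2)          ≡⟨ *-distribˡ-+ 2 (suc n) (suc n C 2) ⟩
  2 * suc n + 2 * (suc n C 2)      ≡⟨ cong (2 * suc n +_) (2*nC2≡n*[n∸1] (suc n)) ⟩
  2 * suc n + suc n * n            ≡⟨ cong (2 * suc n +_) (*-comm (suc n) n) ⟩
  2 * suc n + n * suc n            ≡⟨ *-distribʳ-+ (suc n) 2 n ⟨
  suc (suc n) * suc n              ∎
  where open ≡-Reasoning

-- Either n < k, or n ≥ k and then n C k ≥ 1 while n ≤ m = (k ∸ 1) + (m ∸ k + 1).
n≤k∸1+[m∸k+1]*nCk : ∀ {n m k} → n ≤ m → 1 ≤ k → n ≤ (k ∸ 1) + (m ∸ k + 1) * (n C k)
n≤k∸1+[m∸k+1]*nCk {n} {m} {suc k} n≤m _ with suc k ≤? n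
... | no  n≱1+k = ≤-trans (≤-pred (≰⇒> n≱1+k)) (m≤m+n k _)
... | yes 1+k≤n = begin
  n                                 ≤⟨ n≤m ⟩
  m                                 ≡⟨ m+[n∸m]≡n (≤-trans 1+k≤n n≤m) ⟨
  suc k + (m ∸ suc k)               ≡⟨ +-suc k (m ∸ suc k) ⟨
  k + suc (m ∸ suc k)               ≡⟨ cong (k +_) (+-comm 1 (m ∸ suc k)) ⟩
  k + (m ∸ suc k + 1)               ≡⟨ cong (k +_) (*-identityʳ _) ⟨
  k + (m ∸ suc k + 1) * 1           ≤⟨ +-monoʳ-≤ k (*-monoʳ-≤ (m ∸ suc k + 1) (nCk>0 1+k≤n)) ⟩
  k + (m ∸ suc k + 1) * (n C suc k) ∎
  where open ≤-Reasoning

infix 5 _⊆ᵇ_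

_⊆ᵇ_ : ∀ {c} → (Fin c → Bool) → (Fin c → Bool) → Bool
T ⊆ᵇ D = allFin (λ k → if T k then D k else true)

-- ∑ of g T over the subsets T ⊆ Fin c with |T| = t, split according to whether 0 ∈ T.
sumSubsets : (c t : ℕ) → ((Fin c → Bool) → ℕ) → ℕ
sumSubsets c       zero    g = g (λ _ → false)
sumSubsets zero    (suc t) g = 0
sumSubsets (suc c) (suc t) g =
  sumSubsets c (suc t) (g ∘ (false Vector.∷_)) + sumSubsets c t (g ∘ (true Vector.∷_))

sumSubsets-cong : ∀ c t {g h : (Fin c → Bool) → ℕ} →
  (∀ T → g T ≡ h T) → sumSubsets c t g ≡ sumSubsets c t h
sumSubsets-cong c       zero    g≗h = g≗h _
sumSubsets-cong zero    (suc t) g≗h = refl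
sumSubsets-cong (suc c) (suc t) g≗h =
  cong₂ _+_ (sumSubsets-cong c (suc t) (g≗h ∘ (false Vector.∷_)))
            (sumSubsets-cong c t (g≗h ∘ (true Vector.∷_)))

sumSubsets-zero : ∀ c t → sumSubsets c t (λ _ → 0) ≡ 0
sumSubsets-zero c       zero    = refl
sumSubsets-zero zero    (suc t) = refl
sumSubsets-zero (suc c) (suc t) = cong₂ _+_ (sumSubsets-zero c (suc t)) (sumSubsets-zero c t)

sumSubsets-vanishes : ∀ c t g → c < t → sumSubsets c t g ≡ 0
sumSubsets-vanishes zero    (suc t) g _         = refl
sumSubsets-vanishes (suc c) (suc t) g (s≤s c<t) =
  cong₂ _+_ (sumSubsets-vanishes c (suc t) _ (m≤n⇒m≤1+n c<t)) (sumSubsets-vanishes c t _ c<t)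

sumSubsets-sum : ∀ {s} c t (h : (Fin c → Bool) → Fin s → ℕ) →
  sumSubsets c t (λ T → sum (h T)) ≡ sum (λ b → sumSubsets c t (λ T → h T b))
sumSubsets-sum {s} c       zero    h = refl
sumSubsets-sum {s} zero    (suc t) h = sym (sum-replicate-zero s)
sumSubsets-sum {s} (suc c) (suc t) h = trans
  (cong₂ _+_ (sumSubsets-sum c (suc t) (h ∘ (false Vector.∷_)))
             (sumSubsets-sum c t (h ∘ (true Vector.∷_))))
  (sym (∑-distrib-+ (λ b → sumSubsets c (suc t) (λ T → h (false Vector.∷ T) b))
                    (λ b → sumSubsets c t (λ T → h (true Vector.∷ T) b))))

sumSubsets-⊆ᵇ : ∀ c t (D : Fin c → Bool) → sumSubsets c t (λ T → indicator (T ⊆ᵇ D)) ≡ count D C t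
sumSubsets-⊆ᵇ c       zero    D = cong indicator (allFin-intro {c} _ (λ _ → refl))
sumSubsets-⊆ᵇ zero    (suc t) D = refl
sumSubsets-⊆ᵇ (suc c) (suc t) D with D zero
... | true  = trans (cong₂ _+_ (sumSubsets-⊆ᵇ c (suc t) (D ∘ suc)) (sumSubsets-⊆ᵇ c t (D ∘ suc)))
                    (trans (+-comm (count (D ∘ suc) C suc t) _) (nCk+nC[k+1]≡[n+1]C[k+1] _ t))
... | false = trans (cong₂ _+_ (sumSubsets-⊆ᵇ c (suc t) (D ∘ suc)) (sumSubsets-zero c t)) (+-identityʳ _)

private
  +-≤-⊔-* : ∀ {a b} x y p q → a ≤ x * p → b ≤ y * q → a + b ≤ (x ⊔ y) * (p + q)
  +-≤-⊔-* {a} {b} x y p q a≤xp b≤yq = begin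
    a + b                      ≤⟨ +-mono-≤ (≤-trans a≤xp (*-monoˡ-≤ p (m≤m⊔n x y)))
                                           (≤-trans b≤yq (*-monoˡ-≤ q (m≤n⊔m x y))) ⟩
    (x ⊔ y) * p + (x ⊔ y) * q  ≡⟨ *-distribˡ-+ (x ⊔ y) p q ⟨
    (x ⊔ y) * (p + q)          ∎
    where open ≤-Reasoning

  ≤-⊔-*-sel : ∀ {a} x y p → a ≤ (x ⊔ y) * p → a ≤ x * p ⊎ a ≤ y * p
  ≤-⊔-*-sel x y p a≤ with ⊔-sel x y
  ... | inj₁ x⊔y≡x = inj₁ (subst (λ m → _ ≤ m * p) x⊔y≡x a≤)
  ... | inj₂ x⊔y≡y = inj₂ (subst (λ m → _ ≤ m * p) x⊔y≡y a≤)

sumSubsets-≤-max : ∀ c t g → t ≤ c → ∃ λ T → count T ≡ t × sumSubsets c t g ≤ g T * (c C t)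
sumSubsets-≤-max c zero g _ = (λ _ → false) , count-const-false c , ≤-reflexive (sym (*-identityʳ _))
sumSubsets-≤-max (suc c) (suc t) g (s≤s t≤c)
  with sumSubsets-≤-max c t (g ∘ (true Vector.∷_)) t≤c | suc t ≤? c
... | T₂ , |T₂|≡t , bound₂ | no c≤t = true Vector.∷ T₂ , cong suc |T₂|≡t , (begin
  sumSubsets (suc c) (suc t) g
    ≡⟨ cong (_+ sumSubsets c t (g ∘ (true Vector.∷_))) (sumSubsets-vanishes c (suc t) _ (≰⇒> c≤t)) ⟩
  sumSubsets c t (g ∘ (true Vector.∷_))
    ≤⟨ bound₂ ⟩
  y * (c C t)
    ≤⟨ *-monoʳ-≤ y (m≤m+n (c C t) (c C suc t)) ⟩
  y * (c C t + c C suc t)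
    ≡⟨ cong (y *_) (nCk+nC[k+1]≡[n+1]C[k+1] c t) ⟩
  y * (suc c C suc t) ∎)
  where
  open ≤-Reasoning
  y : ℕ
  y = g (true Vector.∷ T₂)
... | T₂ , |T₂|≡t , bound₂ | yes t<c
  with sumSubsets-≤-max c (suc t) (g ∘ (false Vector.∷_)) t<c
...   | T₁ , |T₁|≡1+t , bound₁ = pick (≤-⊔-*-sel x y (suc c C suc t) bound)
  where
  x y : ℕ
  x = g (false Vector.∷ T₁)
  y = g (true Vector.∷ T₂)
  pascal : c C suc t + c C t ≡ suc c C suc t
  pascal = trans (+-comm (c C suc t) (c C t)) (nCk+nC[k+1]≡[n+1]C[k+1] c t)
  bound : sumSubsets (suc c) (suc t) g ≤ (x ⊔ y) * (suc c C suc t)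
  bound = subst (λ m → sumSubsets (suc c) (suc t) g ≤ (x ⊔ y) * m) pascal
                (+-≤-⊔-* x y (c C suc t) (c C t) bound₁ bound₂)
  pick : ∀ {a} → a ≤ x * (suc c C suc t) ⊎ a ≤ y * (suc c C suc t) →
         ∃ λ T → count T ≡ suc t × a ≤ g T * (suc c C suc t)
  pick (inj₁ a≤) = false Vector.∷ T₁ , |T₁|≡1+t , a≤
  pick (inj₂ a≤) = true Vector.∷ T₂ , cong suc |T₂|≡t , a≤

induced : ∀ {n s} → Graph n → (Fin s → Fin n) → Graph s
induced G ι = record
  { adj        = λ a b → adj G (ι a) (ι b)
  ; adj-sym    = λ a b → adj-sym G (ι a) (ι b)
  ; adj-irrefl = λ a → adj-irrefl G (ι a)
  }

degree : ∀ {n} → Graph n → Fin n → ℕ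
degree G u = count (adj G u)

private
  upward : ∀ {n} → Graph n → Fin n → Fin n → ℕ
  upward G u v = indicator ((toℕ u <ᵇ toℕ v) ∧ adj G u v)

  <ᵇ-true : ∀ {m n} → m < n → (m <ᵇ n) ≡ true
  <ᵇ-true = dec-true (_ <? _)

  <ᵇ-false : ∀ {m n} → ¬ m < n → (m <ᵇ n) ≡ false
  <ᵇ-false = dec-false (_ <? _)

  indicator-adj : ∀ {n} (G : Graph n) u v → indicator (adj G u v) ≡ upward G u v + upward G v u
  indicator-adj G u v with <-cmp (toℕ u) (toℕ v)
  ... | tri< u<v _ v≮u rewrite <ᵇ-true u<v | <ᵇ-false v≮u = sym (+-identityʳ _)
  ... | tri> u≮v _ v<u rewrite <ᵇ-false u≮v | <ᵇ-true v<u = cong indicator (adj-sym G u v)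
  ... | tri≈ _ u≡v _ with toℕ-injective u≡v
  ...   | refl rewrite <ᵇ-false (n≮n (toℕ u)) | adj-irrefl G u = refl

  edgeCount≡sum-upward : ∀ {n} (G : Graph n) → edgeCount G ≡ sum (λ u → sum (upward G u))
  edgeCount≡sum-upward G =
    trans (sumFin≡sum (λ u → count (λ v → (toℕ u <ᵇ toℕ v) ∧ adj G u v)))
          (sum-cong-≗ (λ u → count≡sum (λ v → (toℕ u <ᵇ toℕ v) ∧ adj G u v)))

handshake : ∀ {n} (G : Graph n) → sum (degree G) ≡ 2 * edgeCount G
handshake G = begin
  sum (degree G)
    ≡⟨ sum-cong-≗ (λ u → trans (count≡sum (adj G u)) (sum-cong-≗ (indicator-adj G u))) ⟩
  sum (λ u → sum (λ v → up u v + up v u))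
    ≡⟨ sum-cong-≗ (λ u → ∑-distrib-+ (up u) (λ v → up v u)) ⟩
  sum (λ u → sum (up u) + sum (λ v → up v u))
    ≡⟨ ∑-distrib-+ (λ u → sum (up u)) (λ u → sum (λ v → up v u)) ⟩
  E + sum (λ u → sum (λ v → up v u))
    ≡⟨ cong (E +_) (trans (∑-comm (λ u v → up v u)) (sym (+-identityʳ E))) ⟩
  2 * E
    ≡⟨ cong (2 *_) (edgeCount≡sum-upward G) ⟨
  2 * edgeCount G ∎
  where
  open ≡-Reasoning
  up : Fin _ → Fin _ → ℕ
  up = upward G
  E : ℕ
  E = sum (λ u → sum (up u))

∪G-embedding : ∀ {n r k s} {F₁ : Graph r} {F₂ : Graph k} {G : Graph n}
  (f : Embedding F₁ G) (ι : Fin s → Fin n) → Injective _≡_ _≡_ ι →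
  (∀ i b → proj₁ f i ≢ ι b) → Embedding F₂ (induced G ι) → Embedding (F₁ ∪G F₂) G
∪G-embedding {r = r} {k} {F₁ = F₁} {F₂} {G} (f , f-inj , f-hom) ι ι-inj disjoint (g , g-inj , g-hom) =
  ψ ∘ splitAt r , φ-inj , φ-hom
  where
  ψ : Fin r ⊎ Fin k → Fin _
  ψ = [ f , ι ∘ g ]′
  ψ-inj : Injective _≡_ _≡_ ψ
  ψ-inj {inj₁ i} {inj₁ j} eq = cong inj₁ (f-inj eq)
  ψ-inj {inj₂ a} {inj₂ b} eq = cong inj₂ (g-inj (ι-inj eq))
  ψ-inj {inj₁ i} {inj₂ b} eq = ⊥-elim (disjoint i (g b) eq)
  ψ-inj {inj₂ a} {inj₁ j} eq = ⊥-elim (disjoint j (g a) (sym eq))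
  φ-inj : Injective _≡_ _≡_ (ψ ∘ splitAt r)
  φ-inj {x} {y} eq = begin
    x                        ≡⟨ join-splitAt r k x ⟨
    join r k (splitAt r x)   ≡⟨ cong (join r k) (ψ-inj {splitAt r x} {splitAt r y} eq) ⟩
    join r k (splitAt r y)   ≡⟨ join-splitAt r k y ⟩
    y                        ∎
    where open ≡-Reasoning
  φ-hom : ∀ x y → adj (F₁ ∪G F₂) x y ≡ true → adj G (ψ (splitAt r x)) (ψ (splitAt r y)) ≡ true
  φ-hom x y with splitAt r x | splitAt r y
  ... | inj₁ i | inj₁ j = f-hom i j
  ... | inj₂ a | inj₂ b = g-hom a b
  ... | inj₁ i | inj₂ b = λ ()
  ... | inj₂ a | inj₁ j = λ ()

-- Edges across a split

module _ {n c s} {P : Fin n → Bool} (σ : Split P c s) (G : Graph n) where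
  open Split σ

  leftNbhd : Fin s → Fin c → Bool
  leftNbhd b k = adj G (inl k) (inr b)

  crossEdges : ℕ
  crossEdges = sum (count ∘ leftNbhd)

  edgeCount-split : edgeCount G ≤ c C 2 + crossEdges + edgeCount (induced G inr)
  edgeCount-split = *-cancelˡ-≤ 2 (begin
    2 * edgeCount G
      ≡⟨ handshake G ⟨
    sum (degree G)
      ≡⟨ sum-split (degree G) ⟩
    sum (degree G ∘ inl) + sum (degree G ∘ inr)
      ≡⟨ cong₂ _+_ (sum-cong-≗ (count-split ∘ adj G ∘ inl))
                   (sum-cong-≗ (count-split ∘ adj G ∘ inr)) ⟩
    sum (λ k → inside k + leaving k) + sum (λ b → entering b + outside b)
      ≡⟨ cong₂ _+_ (∑-distrib-+ inside leaving) (∑-distrib-+ entering outside) ⟩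
    (sum inside + sum leaving) + (sum entering + sum outside)
      ≤⟨ +-mono-≤ (+-mono-≤ inside≤ (≤-reflexive leaving≡))
                  (≤-reflexive (cong₂ _+_ entering≡ (handshake (induced G inr)))) ⟩
    (2 * (c C 2) + crossEdges) + (crossEdges + 2 * edgeCount (induced G inr))
      ≡⟨ regroup (c C 2) crossEdges (edgeCount (induced G inr)) ⟩
    2 * (c C 2 + crossEdges + edgeCount (induced G inr)) ∎)
    where
    open ≤-Reasoning
    regroup : ∀ a e h → (2 * a + e) + (e + 2 * h) ≡ 2 * (a + e + h)
    regroup = solve-∀
    inside leaving : Fin c → ℕ
    inside  k = count (adj G (inl k) ∘ inl)
    leaving k = count (adj G (inl k) ∘ inr)
    entering outside : Fin s → ℕ
    entering b = count (adj G (inr b) ∘ inl)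
    outside  b = count (adj G (inr b) ∘ inr)
    inside≤ : sum inside ≤ 2 * (c C 2)
    inside≤ = begin
      sum inside                ≤⟨ sum-mono-≤ (λ k → count≤n∸1 _ k (adj-irrefl G (inl k))) ⟩
      sum {c} (λ _ → c ∸ 1)     ≡⟨ sum-const {c} (c ∸ 1) ⟩
      c * (c ∸ 1)               ≡⟨ 2*nC2≡n*[n∸1] c ⟨
      2 * (c C 2)               ∎
    leaving≡ : sum leaving ≡ crossEdges
    leaving≡ = sum-count-comm (λ k b → adj G (inl k) (inr b))
    entering≡ : sum entering ≡ crossEdges
    entering≡ = sum-cong-≗ (λ b → count-cong (λ k → adj-sym G (inr b) (inl k)))

  commonNbhd-image : ∀ T b → T ⊆ᵇ leftNbhd b ≡ true → commonNbhd G (image inl T) (inr b) ≡ true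
  commonNbhd-image T b T⊆N = allFin-intro _ adjacent
    where
    adjacent : ∀ u → (if image inl T u then adj G u (inr b) else true) ≡ true
    adjacent u with image inl T u in Tu
    ... | false = refl
    ... | true with image-holds inl T u Tu
    ...   | k , Tk , refl =
      subst (λ x → (if x then adj G (inl k) (inr b) else true) ≡ true) Tk (allFin-elim _ T⊆N k)

  commonRightNbhd : (Fin c → Bool) → ℕ
  commonRightNbhd T = count (λ b → T ⊆ᵇ leftNbhd b)

  commonRightNbhd≤size : ∀ T → commonRightNbhd T ≤ size (commonNbhd G (image inl T))
  commonRightNbhd≤size T = begin
    commonRightNbhd T                  ≤⟨ count-mono (commonNbhd-image T) ⟩
    count (N ∘ inr)                    ≤⟨ m≤n+m _ _ ⟩
    count (N ∘ inl) + count (N ∘ inr)  ≡⟨ count-split N ⟨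
    count N                            ∎
    where
    open ≤-Reasoning
    N : VSet n
    N = commonNbhd G (image inl T)

  -- Double counting of the pairs (b, T) with T ⊆ N(inr b) and |T| = t.
  sum-leftDegree-C : ∀ t → sum (λ b → count (leftNbhd b) C t) ≡ sumSubsets c t commonRightNbhd
  sum-leftDegree-C t = begin
    sum (λ b → count (leftNbhd b) C t)
      ≡⟨ sum-cong-≗ (λ b → sumSubsets-⊆ᵇ c t (leftNbhd b)) ⟨
    sum (λ b → sumSubsets c t (λ T → indicator (T ⊆ᵇ leftNbhd b)))
      ≡⟨ sumSubsets-sum c t (λ T b → indicator (T ⊆ᵇ leftNbhd b)) ⟨
    sumSubsets c t (λ T → sum (λ b → indicator (T ⊆ᵇ leftNbhd b)))
      ≡⟨ sumSubsets-cong c t (λ T → count≡sum (λ b → T ⊆ᵇ leftNbhd b)) ⟨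
    sumSubsets c t commonRightNbhd ∎
    where open ≡-Reasoning

  crossEdges≤commonNbhd : ∀ {t} → 1 ≤ t → t ≤ c → ∃ λ T → count T ≡ t ×
    crossEdges ≤ s * (t ∸ 1) + size (commonNbhd G (image inl T)) * ((c ∸ t + 1) * (c C t))
  crossEdges≤commonNbhd {t} 1≤t t≤c with sumSubsets-≤-max c t commonRightNbhd t≤c
  ... | T , |T|≡t , average≤max = T , |T|≡t , (begin
    sum d
      ≤⟨ sum-mono-≤ (λ b → n≤k∸1+[m∸k+1]*nCk (count≤n (leftNbhd b)) 1≤t) ⟩
    sum (λ b → (t ∸ 1) + K * (d b C t))
      ≡⟨ ∑-distrib-+ (λ _ → t ∸ 1) (λ b → K * (d b C t)) ⟩
    sum {s} (λ _ → t ∸ 1) + sum (λ b → K * (d b C t))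
      ≡⟨ cong₂ _+_ (sum-const {s} (t ∸ 1)) (sym (*-distribˡ-sum K (λ b → d b C t))) ⟩
    s * (t ∸ 1) + K * sum (λ b → d b C t)
      ≡⟨ cong (λ x → s * (t ∸ 1) + K * x) (sum-leftDegree-C t) ⟩
    s * (t ∸ 1) + K * sumSubsets c t commonRightNbhd
      ≤⟨ +-monoʳ-≤ (s * (t ∸ 1))
                   (*-monoʳ-≤ K (≤-trans average≤max (*-monoˡ-≤ (c C t) (commonRightNbhd≤size T)))) ⟩
    s * (t ∸ 1) + K * (N * (c C t))
      ≡⟨ cong (s * (t ∸ 1) +_) (x∙yz≈y∙xz K N (c C t)) ⟩
    s * (t ∸ 1) + N * (K * (c C t)) ∎)
    where
    open ≤-Reasoning
    d : Fin s → ℕ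
    d = count ∘ leftNbhd
    K N : ℕ
    K = c ∸ t + 1
    N = size (commonNbhd G (image inl T))

open import Data.Integer using (+_; _-_; +≤+) renaming (_≤_ to _≤ℤ_)
import Data.Integer as ℤ
import Data.Integer.Properties as ℤ
import Data.Integer.Tactic.RingSolver as ℤ

+m-+e-+c-+x≤+y : ∀ {m} e c x {y} → m ≤ c + (x + y) + e → + m - + e - + c - + x ≤ℤ + y
+m-+e-+c-+x≤+y {m} e c x {y} m≤ = begin
  + m - + e - + c - + x                ≡⟨ regroup (+ m) (+ e) (+ c) (+ x) ⟩
  + m - + (c + x + e)                  ≤⟨ ℤ.+-monoˡ-≤ (ℤ.- + (c + x + e)) (+≤+ m≤) ⟩
  + (c + (x + y) + e) - + (c + x + e)  ≡⟨ cancel (+ e) (+ c) (+ x) (+ y) ⟩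
  + y                                  ∎
  where
  open ℤ.≤-Reasoning
  regroup : ∀ m e c x → m - e - c - x ≡ m - (c ℤ.+ x ℤ.+ e)
  regroup = ℤ.solve-∀
  cancel : ∀ e c x y → c ℤ.+ (x ℤ.+ y) ℤ.+ e - (c ℤ.+ x ℤ.+ e) ≡ y
  cancel = ℤ.solve-∀

mainTheorem3 : ∀ {n r k} (G : Graph n) (F₁ : Graph r) (F₂ : Graph k) (t : ℕ) →
    r ≤ n → 1 ≤ t → t ≤ r →
    (e : ℕ) → IsEx (n ∸ r) F₂ e →
    ¬ ((F₁ ∪G F₂) ⊆G G) →
    (f : Embedding F₁ G) →
    Σ (VSet n) λ S →
    InCopy {F = F₁} {G = G} f S × size S ≡ t ×
    (((+ edgeCount G) - (+ e) - (+ (r C 2))) - (+ ((n ∸ r) * (t ∸ 1))))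
    ≤ℤ (+ (size (commonNbhd G S) * ((r ∸ t + 1) * (r C t))))
mainTheorem3 {n} {r} G F₁ F₂ t _ 1≤t t≤r e (_ , ex-maximal) F₁∪F₂⊈G f@(φ , φ-injective , _) =
  image inl T , inCopy , trans (size-image T) |T|≡t ,
  +m-+e-+c-+x≤+y e (r C 2) ((n ∸ r) * (t ∸ 1)) edges≤
  where
  σ : Split (range φ) r (n ∸ r)
  σ = rangeSplit φ-injective
  open Split σ
  bound : (Fin r → Bool) → ℕ
  bound T = (n ∸ r) * (t ∸ 1) + size (commonNbhd G (image inl T)) * ((r ∸ t + 1) * (r C t))
  dense : ∃ λ T → count T ≡ t × crossEdges σ G ≤ bound T
  dense = crossEdges≤commonNbhd σ G 1≤t t≤r
  T : Fin r → Bool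
  T = proj₁ dense
  |T|≡t : count T ≡ t
  |T|≡t = proj₁ (proj₂ dense)
  outside-free : ¬ (F₂ ⊆G induced G inr)
  outside-free = F₁∪F₂⊈G ∘ ∪G-embedding {G = G} f inr inr-injective (λ i b → inr-avoids b (range-contains φ i))
  inCopy : InCopy {F = F₁} {G = G} f (image inl T)
  inCopy v Sv with image-holds inl T v Sv
  ... | k , _ , refl with image-holds φ _ (inl k) (inl-holds k)
  ...   | i , _ , φi≡inl-k = i , φi≡inl-k
  edges≤ : edgeCount G ≤ r C 2 + bound T + e
  edges≤ = ≤-trans (edgeCount-split σ G)
                   (+-mono-≤ (+-monoʳ-≤ (r C 2) (proj₂ (proj₂ dense))) (ex-maximal (induced G inr) outside-free))
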